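{- Let $\mathcal R^{\mathsf{fip}}=\mathcal R(\mathsf{fip},\gamma^{\max})$, $r\in\mathcal R^{\mathsf{fip}}$, and $\varphi$ a formula. If $(\mathcal R^{\mathsf{fip}},r,t)\vDash K_i\varphi$ and $(i,t)\rightsquigarrow(j,t')$ in $r$, then $(\mathcal R^{\mathsf{fip}},r,t')\vDash K_j\big(@_t K_i\varphi\big)$.
   Context: Model: a finite set of processes communicates over a directed network; each channel $i\to j$ has a known integer upper bound $b_{ij}\ge1$. Time is global and discrete, and every local state contains the current time. In $\gamma^{\max}$, a message sent on $i\to j$ at time $s$ is received at a nondeterministically chosen time in $[s+1,s+b_{ij}]$; processes may receive nondeterministic external inputs. $\mathcal R(P,\gamma^{\max})$ is the set of all runs of protocol $P$. A node $(i,t)$ is process $i$ at time $t$; $r_i(t)$ is $i$'s local state. Full-information protocol $\mathsf{fip}$: every process sends its local state on each of its outgoing channels at every time step, and retains a history of every local event and every message received, with their times. Knowledge: $(\mathcal R,r,t)\vDash K_i\varphi$ iff $(\mathcal R,r',t)\vDash\varphi$ for all $r'\in\mathcal R$ with $r'_i(t)=r_i(t)$. Timestamp: $(\mathcal R,r,s)\vDash @_t\varphi$ iff $(\mathcal R,r,t)\vDash\varphi$. Syncausality $\rightsquigarrow$ in $r$: the smallest relation on nodes with (1) $(i,t)\rightsquigarrow(i,t')$ if $t\le t'$; (2) $(i,t)\rightsquigarrow(j,t')$ if a message sent at $(i,t)$ is received at $(j,t')$; (3) $(i,t)\rightsquigarrow(j,t+b_{ij})$ if $j$ is a neighbour of $i$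 and $i$ sends no message to $j$ at time $t$; (4) transitivity. -}

module Defs where

open import Data.Nat using (ℕ; zero; suc; _+_; _≤_; _≟_)
open import Data.Fin using (Fin)
open import Data.Bool using (Bool; true; false; if_then_else_)
open import Data.List using (List; []; _∷_; [_]; _++_; map; filter; concatMap; allFin)
open import Data.Product using (_×_; _,_; proj₁; proj₂)
open import Relation.Binary.PropositionalEquality using (_≡_)
open import Relation.Nullary using (¬_)

-- Network: processes are Fin n; edge i j = true iff there is a channel
-- i → j; b i j is its (integer) upper bound, required to be ≥ 1.

record Net (n : ℕ) : Set where
  field
    edge  : Fin n → Fin n → Bool
    b     : Fin n → Fin n → ℕ
    b≥1   : ∀ i j → edge i j ≡ true → 1 ≤ b i j
open Net public

-- Local states of the full-information protocol fip.
-- start i e    : state of process i at time 0 with external input e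
-- tick σ e ms  : state at time t+1, extending the state σ at time t by the
--                external input e received at t+1 and the list ms of
--                messages received at t+1; each message is recorded as
--                (sender, sending time, sender's local state at sending time).
-- The current time is the number of ticks.

data LState (n : ℕ) (Ext : Set) : Set where
  start : Fin n → Ext → LState n Ext
  tick  : LState n Ext → Ext → List (Fin n × ℕ × LState n Ext) → LState n Ext

module _ {n : ℕ} (N : Net n) (Ext : Set) where

  -- A run of fip in γ^max: nondeterministic external inputs and,
  -- for every channel i → j and sending time s, the transmission delay
  -- of the message sent on i → j at time s (received at s + delay),
  -- constrained to [1, b i j].
  record Run : Set where
    field
      ext        : Fin n → ℕ → Ext
      delay      : Fin n → Fin n → ℕ → ℕ
      delay-ok   : ∀ i j s → edge N i j ≡ true →
                   (1 ≤ delay i j s) × (delay i j s ≤ b N i j)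
  open Run public

  Snap : Set
  Snap = Fin n → LState n Ext

  -- messages received by process i at time T, given the history h
  -- (list of (time, global snapshot) for all earlier times)
  inbox : Run → ℕ → List (ℕ × Snap) → Fin n → List (Fin n × ℕ × LState n Ext)
  inbox r T h i = concatMap from (allFin n)
    where
    from : Fin n → List (Fin n × ℕ × LState n Ext)
    from j = if edge N j i
               then map (λ p → j , proj₁ p , proj₂ p j)
                        (filter (λ p → proj₁ p + delay r j i (proj₁ p) ≟ T) h)
               else []

  -- (current snapshot at time t , ascending list of (s , snapshot at s) for s ≤ t)
  histC : Run → ℕ → Snap × List (ℕ × Snap)
  histC r zero = s0 , [ (0 , s0) ]
    where
    s0 : Snap
    s0 i = start i (ext r i 0)
  histC r (suc t) = new , (proj₂ (histC r t) ++ [ (suc t , new) ])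
    where
    new : Snap
    new i = tick (proj₁ (histC r t) i) (ext r i (suc t))
                 (inbox r (suc t) (proj₂ (histC r t)) i)

  lstate : Run → Fin n → ℕ → LState n Ext
  lstate r i t = proj₁ (histC r t) i

  -- In fip every process sends on every outgoing channel at every time.
  Sends : Run → Fin n → Fin n → ℕ → Set
  Sends r i j t = edge N i j ≡ true

  data Syn (r : Run) : Fin n × ℕ → Fin n × ℕ → Set where
    local  : ∀ {i t t'} → t ≤ t' → Syn r (i , t) (i , t')
    msg    : ∀ {i j t} → Sends r i j t →
             Syn r (i , t) (j , t + delay r i j t)
    silent : ∀ {i j t} → edge N i j ≡ true → ¬ Sends r i j t →
             Syn r (i , t) (j , t + b N i j)
    trans  : ∀ {x y z} → Syn r x y → Syn r y z → Syn r x z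

  -- Facts (semantics of formulas): properties of points (r , t).
  Fact : Set₁
  Fact = Run → ℕ → Set

  K : Fin n → Fact → Fact
  K i φ r t = ∀ (r' : Run) → lstate r' i t ≡ lstate r i t → φ r' t

  At : ℕ → Fact → Fact
  At t φ r s = φ r t

module Submission where

-- In fip a local state is a complete record of the process's past,
-- so the state of j at a node (j , t') determines the state of every node
-- (i , t) syncausally before it: if a run r' agrees with r at (j , t'),
-- it also agrees with r at (i , t).  Given this, any run r'' that i cannot
-- distinguish from r' at time t is one that i cannot distinguish from r at
-- time t, hence satisfies φ; that is exactly K_j (@_t K_i φ) at (r , t').
--
-- The determination lemma is proved by induction on the syncausality
-- derivation, from two recall facts:
--   * local recall: a state at time t' contains the state at any t ≤ t';
--   * message recall: the state of j when a message from i arrives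
--     contains the state of i when the message was sent.  Silent steps never
-- occur in fip, since every process sends on every channel at every time.

open import Defs
open import Data.Nat using (ℕ; zero; suc; _+_; _≤_; _≤′_; ≤′-refl; ≤′-step; z≤n; s≤s)
open import Data.Nat.Properties using (+-suc; ≤⇒≤′; m≤m+n; m≤n⇒m<n∨m≡n)
open import Data.Fin using (Fin)
open import Data.Bool using (Bool; true; false; if_then_else_)
open import Data.List using (List; []; allFin)
open import Data.List.Relation.Unary.All using (All; []; _∷_; lookup)
open import Data.List.Relation.Unary.All.Properties using (++⁺)
open import Data.List.Relation.Unary.Any using (here; satisfied)
open import Data.List.Membership.Propositional using (_∈_; lose)
open import Data.List.Membership.Propositional.Properties
  using (∈-map⁺; ∈-map⁻; ∈-filter⁺; ∈-filter⁻; ∈-concatMap⁺; ∈-concatMap⁻; ∈-allFin; ∈-++⁺ˡ; ∈-++⁺ʳ)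
open import Data.Product using (_×_; _,_; proj₁; proj₂; ∃)
open import Data.Sum using (inj₁; inj₂)
open import Data.Empty using (⊥-elim)
open import Function using (_∘_)
open import Relation.Binary.PropositionalEquality using (_≡_; refl; sym; cong; subst)
  renaming (trans to ≡-trans)

∈-if⁻ : ∀ {A : Set} {x : A} {xs : List A} (c : Bool) →
        x ∈ (if c then xs else []) → x ∈ xs
∈-if⁻ true  x∈xs = x∈xs
∈-if⁻ false ()

∈-if⁺ : ∀ {A : Set} {x : A} {xs : List A} {c : Bool} →
        c ≡ true → x ∈ xs → x ∈ (if c then xs else [])
∈-if⁺ refl x∈xs = x∈xs

arrival-pred : ∀ t d → 1 ≤ d → ∃ λ T → t ≤ T × t + d ≡ suc T
arrival-pred t (suc d) _ = t + d , m≤m+n t d , +-suc t d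

module _ {n : ℕ} (N : Net n) (Ext : Set) where

  private
    State = LState n Ext
    Message = Fin n × ℕ × State

  previous : State → State
  previous (start i e)  = start i e
  previous (tick σ _ _) = σ

  received : State → List Message
  received (start _ _)   = []
  received (tick _ _ ms) = ms

  Agree : Run N Ext → Run N Ext → Fin n × ℕ → Set
  Agree r r' (i , t) = lstate N Ext r' i t ≡ lstate N Ext r i t

  history : Run N Ext → ℕ → List (ℕ × Snap N Ext)
  history r T = proj₂ (histC N Ext r T)

  Faithful : Run N Ext → ℕ × Snap N Ext → Set
  Faithful r (s , σ) = σ ≡ proj₁ (histC N Ext r s)

  history-faithful : ∀ r T → All (Faithful r) (history r T)
  history-faithful r zero    = refl ∷ []
  history-faithful r (suc T) = ++⁺ (history-faithful r T) (refl ∷ [])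

  history-complete : ∀ r {t} T → t ≤ T → (t , proj₁ (histC N Ext r t)) ∈ history r T
  history-complete r zero    z≤n = here refl
  history-complete r (suc T) t≤1+T with m≤n⇒m<n∨m≡n t≤1+T
  ... | inj₁ (s≤s t≤T) = ∈-++⁺ˡ (history-complete r T t≤T)
  ... | inj₂ refl      = ∈-++⁺ʳ (history r T) (here refl)

  local-recall : ∀ r r' i {t t'} → t ≤′ t' → Agree r r' (i , t') → Agree r r' (i , t)
  local-recall r r' i ≤′-refl           agree = agree
  local-recall r r' i (≤′-step t≤′t') agree =
    local-recall r r' i t≤′t' (cong previous agree)

  inbox-sound : ∀ r T h j {m : Message} → All (Faithful r) h →
                m ∈ inbox N Ext r T h j →
                proj₂ (proj₂ m) ≡ lstate N Ext r (proj₁ m) (proj₁ (proj₂ m))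
  inbox-sound r T h j faithful m∈inbox
    with satisfied (∈-concatMap⁻ _ {xs = allFin n} m∈inbox)
  ... | k , m∈from with ∈-map⁻ _ (∈-if⁻ (edge N k j) m∈from)
  ... | p , p∈filtered , refl =
    cong (λ σ → σ k) (lookup faithful (proj₁ (∈-filter⁻ _ {xs = h} p∈filtered)))

  inbox-complete : ∀ r T h {i j t} → edge N i j ≡ true →
                   (t , proj₁ (histC N Ext r t)) ∈ h → t + delay r i j t ≡ T →
                   (i , t , lstate N Ext r i t) ∈ inbox N Ext r T h j
  inbox-complete r T h {i} e recorded arrives =
    ∈-concatMap⁺ _ {xs = allFin n}
      (lose (∈-allFin i) (∈-if⁺ e (∈-map⁺ _ (∈-filter⁺ _ recorded arrives))))

  message-recall : ∀ r r' {i j t} (e : edge N i j ≡ true) →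
                   Agree r r' (j , t + delay r i j t) → Agree r r' (i , t)
  message-recall r r' {i} {j} {t} e agree
    with arrival-pred t (delay r i j t) (proj₁ (delay-ok r i j t e))
  ... | T , t≤T , arrives = sym (inbox-sound r' (suc T) (history r' T) j
          (history-faithful r' T) in-r'-inbox)
    where
    -- j's state at time suc T records its inbox, which contains i's message.
    in-r-inbox : (i , t , lstate N Ext r i t) ∈ received (lstate N Ext r j (suc T))
    in-r-inbox = inbox-complete r (suc T) (history r T) e (history-complete r T t≤T) arrives

    in-r'-inbox : (i , t , lstate N Ext r i t) ∈ received (lstate N Ext r' j (suc T))
    in-r'-inbox = subst (λ σ → (i , t , lstate N Ext r i t) ∈ received σ)
                    (sym (subst (λ u → Agree r r' (j , u)) arrives agree)) in-r-inbox

  syncausal-recall : ∀ r r' {x y} → Syn N Ext r x y → Agree r r' y → Agree r r' x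
  syncausal-recall r r' (local t≤t')     = local-recall r r' _ (≤⇒≤′ t≤t')
  syncausal-recall r r' (msg {t = t} e)  = message-recall r r' {t = t} e
  syncausal-recall r r' (silent e ¬e)    = ⊥-elim (¬e e)
  syncausal-recall r r' (trans x⇝y y⇝z)  =
    syncausal-recall r r' x⇝y ∘ syncausal-recall r r' y⇝z

mainTheorem15 : ∀ {n : ℕ} (N : Net n) (Ext : Set) (φ : Fact N Ext)
                  (r : Run N Ext) (i j : Fin n) (t t' : ℕ) →
                  K N Ext i φ r t →
                  Syn N Ext r (i , t) (j , t') →
                  K N Ext j (At N Ext t (K N Ext i φ)) r t'
mainTheorem15 N Ext φ r i j t t' knows i⇝j r' r'≈r r'' r''≈r' =
  knows r'' (≡-trans r''≈r' (syncausal-recall N Ext r r' i⇝j r'≈r))
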